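{- Let $k\geq 2$, let $f\colon\mathbb{F}_2^k\to\mathbb{F}_2$ be a Boolean function, let $s\geq 2$ be an integer, and define $f_s\colon\mathbb{F}_2^{(k-1)s+1}\to\mathbb{F}_2$ by \[ f_s(x_1,\dotsc,x_{(k-1)s+1})=f(x_1, x_{s+1}, x_{2s+1},\dotsc, x_{(k-1)s+1}). \] If $f$ is a $(k,n)$-lifting for all $n\geq k$, then $f_s$ is a $((k-1)s+1,n)$-lifting for all $n\geq (k-1)s+1$.
   Context: A Boolean function $f\colon\mathbb{F}_2^k\to\mathbb{F}_2$ induces, for every $n\geq k$, the shift-invariant map $F\colon\mathbb{F}_2^n\to\mathbb{F}_2^n$ given by $F(x)_i=f(x_i,x_{i+1},\dotsc,x_{i+k-1})$ for $i=1,\dotsc,n$, with indices taken modulo $n$ (in $\{1,\dotsc,n\}$). The function $f$ has diameter $k$ if it depends on both $x_1$ and $x_k$. For $n\geq k$, $f$ is called a $(k,n)$-lifting if $f$ has diameter $k$ and the induced map $F\colon\mathbb{F}_2^n\to\mathbb{F}_2^n$ is bijective. -}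

module Defs where

open import Data.Nat using (ℕ; zero; suc; _+_; _*_; _∸_; _≤_; _<_; s≤s; z≤n; NonZero)
open import Data.Nat.Properties using (*-monoˡ-≤; ≤-pred; +-comm)
open import Data.Nat.DivMod using (_%_; m%n<n)
open import Data.Bool using (Bool; not)
open import Data.Fin using (Fin; toℕ; fromℕ<)
open import Data.Fin.Properties using (toℕ<n)
open import Data.Vec using (Vec; lookup; tabulate; _[_]%=_)
open import Data.Product using (∃; _×_)
open import Relation.Binary.PropositionalEquality using (_≡_; _≢_; subst)
open import Function.Definitions using (Bijective)

BoolFun : ℕ → Set
BoolFun k = Vec Bool k → Bool

DependsOn : ∀ {k} → BoolFun k → Fin k → Set
DependsOn f i = ∃ λ x → f x ≢ f (x [ i ]%= not)

-- Diameter k: f depends on its first variable (index 0) and its last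
-- variable (index k - 1).
HasDiameter : ∀ {k} → BoolFun k → Set
HasDiameter {k} f = (∃ λ (i : Fin k) → toℕ i ≡ 0 × DependsOn f i)
                  × (∃ λ (i : Fin k) → suc (toℕ i) ≡ k × DependsOn f i)

cyc : ∀ {n} → .{{NonZero n}} → Fin n → ℕ → Fin n
cyc {n} i j = fromℕ< (m%n<n (toℕ i + j) n)

induced : ∀ {k} → BoolFun k → (n : ℕ) → .{{NonZero n}} → Vec Bool n → Vec Bool n
induced {k} f n x = tabulate λ i → f (tabulate λ (j : Fin k) → lookup x (cyc i (toℕ j)))

-- (k,n)-lifting (n ≥ k is a hypothesis at use sites): diameter k and
-- induced map F : F_2^n → F_2^n bijective.
IsLifting : ∀ {k} → BoolFun k → (n : ℕ) → .{{NonZero n}} → Set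
IsLifting f n = HasDiameter f × Bijective _≡_ _≡_ (induced f n)

spread-lt : ∀ m s (j : Fin (suc m)) → toℕ j * s < m * s + 1
spread-lt m s j = subst (toℕ j * s <_) (+-comm 1 (m * s)) (s≤s (*-monoˡ-≤ s (≤-pred (toℕ<n j))))

spread : ∀ {m} → BoolFun (suc m) → (s : ℕ) → BoolFun (m * s + 1)
spread {m} f s x = f (tabulate λ j → lookup x (fromℕ< (spread-lt m s j)))

{-# OPTIONS --safe #-}
module Submission where

-- Let F and F_s be the maps induced by f and f_s on F₂^n.  For a residue r, read x
-- along the progression r, r + s, r + 2s, … (mod n) to get x⁽ʳ⁾ ∈ F₂^n; then
-- (F_s x)⁽ʳ⁾ = F x⁽ʳ⁾, i.e. on every progression F_s acts as F.  As x_r = (x⁽ʳ⁾)_0,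
-- injectivity of F gives injectivity of F_s.  For surjectivity let F ζ_r = y⁽ʳ⁾.
-- By injectivity of F and shift-equivariance, ζ_{r + ts} = σ^t ζ_r for the cyclic
-- shift σ, so x_r := (ζ_r)_0 satisfies x⁽ʳ⁾ = ζ_r and hence F_s x = y.  The diameter
-- is inherited because f_s reads the first and last variables of f at positions 0
-- and (k - 1)s.

open import Defs
open import Data.Nat using (ℕ; suc; _+_; _*_; _≤_; s≤s; NonZero)
open import Data.Nat.Properties using (+-comm; +-identityʳ; suc-injective; m≤m*n; ≤-refl; ≤-trans; ≤-reflexive; ≤-pred)
open import Data.Nat.DivMod using (_%_; _/_; m%n<n; m%n%n≡m%n; %-distribˡ-+; %-distribˡ-*; m<n⇒m%n≡m; m*n/n≡m; /-monoˡ-≤)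
open import Data.Nat.Tactic.RingSolver using (solve-∀)
open import Data.Bool using (Bool; not)
open import Data.Fin using (Fin; toℕ; fromℕ<; _≟_)
open import Data.Fin.Properties using (toℕ<n; fromℕ<-cong; fromℕ<-toℕ; toℕ-fromℕ<; toℕ-injective)
open import Data.Vec using (Vec; lookup; tabulate; _[_]%=_)
open import Data.Vec.Relation.Binary.Pointwise.Extensional using (ext; Pointwise-≡⇒≡)
open import Data.Vec.Properties using (lookup∘tabulate; tabulate∘lookup; tabulate-cong; lookup∘updateAt; lookup∘updateAt′)
open import Data.Product using (_,_; proj₁; proj₂)
open import Function using (_∘_)
open import Function.Definitions using (Bijective; Injective; StrictlySurjective)
open import Function.Consequences.Propositional using (strictlySurjective⇒surjective; surjective⇒strictlySurjective)
open import Relation.Binary.PropositionalEquality using (_≡_; refl; sym; trans; cong; module ≡-Reasoning)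
open import Relation.Nullary using (yes; no)

open ≡-Reasoning

private
  +-swapʳ : ∀ a b c → a + b + c ≡ a + c + b
  +-swapʳ = solve-∀

  progression-step : ∀ r a b s → r + a * s + b * s ≡ r + (a + b) * s
  progression-step = solve-∀

module _ (n : ℕ) .{{_ : NonZero n}} where

  +-congˡ-mod : ∀ c {a b} → a % n ≡ b % n → (c + a) % n ≡ (c + b) % n
  +-congˡ-mod c {a} {b} a≡b = begin
    (c + a) % n            ≡⟨ %-distribˡ-+ c a n ⟩
    (c % n + a % n) % n    ≡⟨ cong (λ u → (c % n + u) % n) a≡b ⟩
    (c % n + b % n) % n    ≡⟨ %-distribˡ-+ c b n ⟨
    (c + b) % n            ∎

  +-congʳ-mod : ∀ c {a b} → a % n ≡ b % n → (a + c) % n ≡ (b + c) % n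
  +-congʳ-mod c {a} {b} a≡b = begin
    (a + c) % n            ≡⟨ %-distribˡ-+ a c n ⟩
    (a % n + c % n) % n    ≡⟨ cong (λ u → (u + c % n) % n) a≡b ⟩
    (b % n + c % n) % n    ≡⟨ %-distribˡ-+ b c n ⟨
    (b + c) % n            ∎

  *-congʳ-mod : ∀ c {a b} → a % n ≡ b % n → (a * c) % n ≡ (b * c) % n
  *-congʳ-mod c {a} {b} a≡b = begin
    (a * c) % n            ≡⟨ %-distribˡ-* a c n ⟩
    (a % n * (c % n)) % n  ≡⟨ cong (λ u → (u * (c % n)) % n) a≡b ⟩
    (b % n * (c % n)) % n  ≡⟨ %-distribˡ-* b c n ⟨
    (b * c) % n            ∎

module _ {A : Set} where

  reindex : ∀ {k K} → (Fin k → Fin K) → Vec A K → Vec A k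
  reindex ι v = tabulate (lookup v ∘ ι)

  reindex-tabulate : ∀ {k K} (ι : Fin k → Fin K) (g : Fin K → A) →
                     reindex ι (tabulate g) ≡ tabulate (g ∘ ι)
  reindex-tabulate ι g = tabulate-cong (lookup∘tabulate g ∘ ι)

  reindex-leftInverse : ∀ {k K} (ι : Fin k → Fin K) (π : Fin K → Fin k) →
                        (∀ j → π (ι j) ≡ j) → ∀ x → reindex ι (reindex π x) ≡ x
  reindex-leftInverse ι π π∘ι≗id x = begin
    reindex ι (reindex π x)     ≡⟨ reindex-tabulate ι (lookup x ∘ π) ⟩
    tabulate (lookup x ∘ π ∘ ι) ≡⟨ tabulate-cong (cong (lookup x) ∘ π∘ι≗id) ⟩
    tabulate (lookup x)         ≡⟨ tabulate∘lookup x ⟩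
    x                           ∎

  reindex-updateAt : ∀ {k K} (ι : Fin k → Fin K) → Injective _≡_ _≡_ ι →
                     ∀ (g : A → A) v i → reindex ι (v [ ι i ]%= g) ≡ reindex ι v [ i ]%= g
  reindex-updateAt ι ι-injective g v i = Pointwise-≡⇒≡ (ext at)
    where
    at : ∀ j → lookup (reindex ι (v [ ι i ]%= g)) j ≡ lookup (reindex ι v [ i ]%= g) j
    at j with j ≟ i
    ... | yes refl = begin
      lookup (reindex ι (v [ ι j ]%= g)) j  ≡⟨ lookup∘tabulate _ j ⟩
      lookup (v [ ι j ]%= g) (ι j)          ≡⟨ lookup∘updateAt (ι j) v ⟩
      g (lookup v (ι j))                    ≡⟨ cong g (lookup∘tabulate _ j) ⟨
      g (lookup (reindex ι v) j)            ≡⟨ lookup∘updateAt j (reindex ι v) ⟨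
      lookup (reindex ι v [ j ]%= g) j      ∎
    ... | no j≢i = begin
      lookup (reindex ι (v [ ι i ]%= g)) j  ≡⟨ lookup∘tabulate _ j ⟩
      lookup (v [ ι i ]%= g) (ι j)          ≡⟨ lookup∘updateAt′ (ι j) (ι i) (j≢i ∘ ι-injective) v ⟩
      lookup v (ι j)                        ≡⟨ lookup∘tabulate _ j ⟨
      lookup (reindex ι v) j                ≡⟨ lookup∘updateAt′ j i j≢i (reindex ι v) ⟨
      lookup (reindex ι v [ i ]%= g) j      ∎

dependsOn-reindex : ∀ {k K} (ι : Fin k → Fin K) (π : Fin K → Fin k) → (∀ j → π (ι j) ≡ j) →
                    ∀ {f : BoolFun k} {i} → DependsOn f i → DependsOn (f ∘ reindex ι) (ι i)
dependsOn-reindex ι π π∘ι≗id {f} {i} (x , fx≢fx′) = reindex π x , λ eq → fx≢fx′ (begin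
  f x                                  ≡⟨ cong f (reindex-leftInverse ι π π∘ι≗id x) ⟨
  f (reindex ι x′)                     ≡⟨ eq ⟩
  f (reindex ι (x′ [ ι i ]%= not))     ≡⟨ cong f (reindex-updateAt ι ι-injective not x′ i) ⟩
  f (reindex ι x′ [ i ]%= not)         ≡⟨ cong (λ v → f (v [ i ]%= not)) (reindex-leftInverse ι π π∘ι≗id x) ⟩
  f (x [ i ]%= not)                    ∎)
  where
  x′ : Vec Bool _
  x′ = reindex π x
  ι-injective : Injective _≡_ _≡_ ι
  ι-injective {j} {j′} ιj≡ιj′ = trans (sym (π∘ι≗id j)) (trans (cong π ιj≡ιj′) (π∘ι≗id j′))

module _ (m s : ℕ) where

  spreadIndex : Fin (suc m) → Fin (m * s + 1)
  spreadIndex j = fromℕ< (spread-lt m s j)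

  toℕ-spreadIndex : ∀ j → toℕ (spreadIndex j) ≡ toℕ j * s
  toℕ-spreadIndex j = toℕ-fromℕ< (spread-lt m s j)

  spread-tabulate : ∀ {f : BoolFun (suc m)} (H : ℕ → Bool) →
                    spread f s (tabulate (H ∘ toℕ)) ≡ f (tabulate λ j → H (toℕ j * s))
  spread-tabulate {f} H = cong f (begin
    reindex spreadIndex (tabulate (H ∘ toℕ)) ≡⟨ reindex-tabulate spreadIndex (H ∘ toℕ) ⟩
    tabulate (H ∘ toℕ ∘ spreadIndex)        ≡⟨ tabulate-cong (cong H ∘ toℕ-spreadIndex) ⟩
    tabulate (λ j → H (toℕ j * s))          ∎)

module _ (m s′ : ℕ) where

  private
    s = suc s′

  blockIndex : Fin (m * s + 1) → Fin (suc m)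
  blockIndex p = fromℕ< (s≤s (≤-trans (/-monoˡ-≤ s p≤m*s) (≤-reflexive (m*n/n≡m m s))))
    where
    p≤m*s : toℕ p ≤ m * s
    p≤m*s = ≤-pred (≤-trans (toℕ<n p) (≤-reflexive (+-comm (m * s) 1)))

  blockIndex-spreadIndex : ∀ j → blockIndex (spreadIndex m s j) ≡ j
  blockIndex-spreadIndex j = toℕ-injective (begin
    toℕ (blockIndex (spreadIndex m s j)) ≡⟨ toℕ-fromℕ< _ ⟩
    toℕ (spreadIndex m s j) / s          ≡⟨ cong (_/ s) (toℕ-spreadIndex m s j) ⟩
    toℕ j * s / s                        ≡⟨ m*n/n≡m (toℕ j) s ⟩
    toℕ j                                ∎)

  spread-hasDiameter : {f : BoolFun (suc m)} → HasDiameter f → HasDiameter (spread f s)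
  spread-hasDiameter {f} ((i , i≡0 , f-i) , (i′ , 1+i′≡k , f-i′)) =
    (spreadIndex m s i , first , dependsOn-spread f-i) ,
    (spreadIndex m s i′ , last , dependsOn-spread f-i′)
    where
    dependsOn-spread : ∀ {j} → DependsOn f j → DependsOn (spread f s) (spreadIndex m s j)
    dependsOn-spread = dependsOn-reindex (spreadIndex m s) blockIndex blockIndex-spreadIndex
    first : toℕ (spreadIndex m s i) ≡ 0
    first = trans (toℕ-spreadIndex m s i) (cong (_* s) i≡0)
    last : suc (toℕ (spreadIndex m s i′)) ≡ m * s + 1
    last = begin
      suc (toℕ (spreadIndex m s i′)) ≡⟨ cong suc (toℕ-spreadIndex m s i′) ⟩
      suc (toℕ i′ * s)               ≡⟨ cong (λ t → suc (t * s)) (suc-injective 1+i′≡k) ⟩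
      suc (m * s)                    ≡⟨ +-comm 1 (m * s) ⟩
      m * s + 1                      ∎

module _ {A : Set} {n : ℕ} .{{_ : NonZero n}} where

  lookup% : Vec A n → ℕ → A
  lookup% x a = lookup x (fromℕ< (m%n<n a n))

  lookup%-cong : ∀ x {a b} → a % n ≡ b % n → lookup% x a ≡ lookup% x b
  lookup%-cong x a≡b = cong (lookup x) (fromℕ<-cong _ _ a≡b _ _)

  lookup%-toℕ : ∀ x i → lookup% x (toℕ i) ≡ lookup x i
  lookup%-toℕ x i = cong (lookup x) (begin
    fromℕ< (m%n<n (toℕ i) n) ≡⟨ fromℕ<-cong _ _ (m<n⇒m%n≡m (toℕ<n i)) _ (toℕ<n i) ⟩
    fromℕ< (toℕ<n i)         ≡⟨ fromℕ<-toℕ i _ ⟩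
    i                        ∎)

  lookup%-ext : ∀ {x y} → (∀ a → lookup% x a ≡ lookup% y a) → x ≡ y
  lookup%-ext {x} {y} x≗y = Pointwise-≡⇒≡ (ext λ i → begin
    lookup x i        ≡⟨ lookup%-toℕ x i ⟨
    lookup% x (toℕ i) ≡⟨ x≗y (toℕ i) ⟩
    lookup% y (toℕ i) ≡⟨ lookup%-toℕ y i ⟩
    lookup y i        ∎)

  lookup%-tabulate : ∀ (H : ℕ → A) a → lookup% (tabulate (H ∘ toℕ)) a ≡ H (a % n)
  lookup%-tabulate H a = trans (lookup∘tabulate (H ∘ toℕ) _) (cong H (toℕ-fromℕ< (m%n<n a n)))

  shift : ℕ → Vec A n → Vec A n
  shift t x = tabulate λ i → lookup% x (toℕ i + t)

  lookup%-shift : ∀ t x a → lookup% (shift t x) a ≡ lookup% x (a + t)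
  lookup%-shift t x a = trans (lookup%-tabulate (λ c → lookup% x (c + t)) a)
                              (lookup%-cong x (+-congʳ-mod n t (m%n%n≡m%n a n)))

  decimate : ℕ → ℕ → Vec A n → Vec A n
  decimate s r x = tabulate λ i → lookup% x (r + toℕ i * s)

  lookup%-decimate : ∀ s r x b → lookup% (decimate s r x) b ≡ lookup% x (r + b * s)
  lookup%-decimate s r x b =
    trans (lookup%-tabulate (λ c → lookup% x (r + c * s)) b)
          (lookup%-cong x (+-congˡ-mod n r (*-congʳ-mod n s (m%n%n≡m%n b n))))

  lookup%-decimate-0 : ∀ s r x → lookup% (decimate s r x) 0 ≡ lookup% x r
  lookup%-decimate-0 s r x = trans (lookup%-decimate s r x 0) (cong (lookup% x) (+-identityʳ r))

  decimate-cong : ∀ s {r r′} x → r % n ≡ r′ % n → decimate s r x ≡ decimate s r′ x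
  decimate-cong s x r≡r′ = tabulate-cong λ i → lookup%-cong x (+-congʳ-mod n (toℕ i * s) r≡r′)

  shift-decimate : ∀ s r t (x : Vec A n) → shift t (decimate s r x) ≡ decimate s (r + t * s) x
  shift-decimate s r t x = lookup%-ext λ a → begin
    lookup% (shift t (decimate s r x)) a  ≡⟨ lookup%-shift t (decimate s r x) a ⟩
    lookup% (decimate s r x) (a + t)      ≡⟨ lookup%-decimate s r x (a + t) ⟩
    lookup% x (r + (a + t) * s)           ≡⟨ cong (lookup% x) (progression-step r a t s) ⟨
    lookup% x (r + a * s + t * s)         ≡⟨ cong (lookup% x) (+-swapʳ r (a * s) (t * s)) ⟩
    lookup% x (r + t * s + a * s)         ≡⟨ lookup%-decimate s (r + t * s) x a ⟨
    lookup% (decimate s (r + t * s) x) a  ∎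

module _ {n : ℕ} .{{_ : NonZero n}} where

  lookup%-induced : ∀ {k} (g : BoolFun k) x a →
                    lookup% (induced g n x) a ≡ g (tabulate λ j → lookup% x (a + toℕ j))
  lookup%-induced g x a = trans (lookup∘tabulate _ (fromℕ< (m%n<n a n)))
    (cong g (tabulate-cong λ j → begin
      lookup% x (toℕ (fromℕ< (m%n<n a n)) + toℕ j) ≡⟨ cong (λ c → lookup% x (c + toℕ j)) (toℕ-fromℕ< (m%n<n a n)) ⟩
      lookup% x (a % n + toℕ j)                    ≡⟨ lookup%-cong x (+-congʳ-mod n (toℕ j) (m%n%n≡m%n a n)) ⟩
      lookup% x (a + toℕ j)                        ∎))

  induced-shift : ∀ {k} (g : BoolFun k) t x → induced g n (shift t x) ≡ shift t (induced g n x)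
  induced-shift g t x = lookup%-ext λ a → begin
    lookup% (induced g n (shift t x)) a                ≡⟨ lookup%-induced g (shift t x) a ⟩
    g (tabulate λ j → lookup% (shift t x) (a + toℕ j)) ≡⟨ cong g (tabulate-cong λ j →
                                                            trans (lookup%-shift t x (a + toℕ j))
                                                                  (cong (lookup% x) (+-swapʳ a (toℕ j) t))) ⟩
    g (tabulate λ j → lookup% x (a + t + toℕ j))       ≡⟨ lookup%-induced g x (a + t) ⟨
    lookup% (induced g n x) (a + t)                    ≡⟨ lookup%-shift t (induced g n x) a ⟨
    lookup% (shift t (induced g n x)) a                ∎

  decimate-induced-spread : ∀ {m} (f : BoolFun (suc m)) s r x →
                            decimate s r (induced (spread f s) n x) ≡ induced f n (decimate s r x)
  decimate-induced-spread {m} f s r x = lookup%-ext λ a → begin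
    lookup% (decimate s r (induced (spread f s) n x)) a       ≡⟨ lookup%-decimate s r (induced (spread f s) n x) a ⟩
    lookup% (induced (spread f s) n x) (r + a * s)            ≡⟨ lookup%-induced (spread f s) x (r + a * s) ⟩
    spread f s (tabulate λ p → lookup% x (r + a * s + toℕ p)) ≡⟨ spread-tabulate m s {f} (λ c → lookup% x (r + a * s + c)) ⟩
    f (tabulate λ j → lookup% x (r + a * s + toℕ j * s))      ≡⟨ cong f (tabulate-cong λ j →
                                                                   cong (lookup% x) (progression-step r a (toℕ j) s)) ⟩
    f (tabulate λ j → lookup% x (r + (a + toℕ j) * s))        ≡⟨ cong f (tabulate-cong λ j →
                                                                   lookup%-decimate s r x (a + toℕ j)) ⟨
    f (tabulate λ j → lookup% (decimate s r x) (a + toℕ j))   ≡⟨ lookup%-induced f (decimate s r x) a ⟨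
    lookup% (induced f n (decimate s r x)) a                  ∎

module _ {n : ℕ} .{{_ : NonZero n}} {m : ℕ} (f : BoolFun (suc m)) (s : ℕ) where

  private
    F F-spread : Vec Bool n → Vec Bool n
    F = induced f n
    F-spread = induced (spread f s) n

  induced-spread-injective : Injective _≡_ _≡_ F → Injective _≡_ _≡_ F-spread
  induced-spread-injective F-injective {x} {x′} Fx≡Fx′ = lookup%-ext λ r → begin
    lookup% x r                   ≡⟨ lookup%-decimate-0 s r x ⟨
    lookup% (decimate s r x) 0    ≡⟨ cong (λ v → lookup% v 0) (F-injective {decimate s r x} {decimate s r x′} (begin
      F (decimate s r x)            ≡⟨ decimate-induced-spread f s r x ⟨
      decimate s r (F-spread x)     ≡⟨ cong (decimate s r) Fx≡Fx′ ⟩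
      decimate s r (F-spread x′)    ≡⟨ decimate-induced-spread f s r x′ ⟩
      F (decimate s r x′)           ∎)) ⟩
    lookup% (decimate s r x′) 0   ≡⟨ lookup%-decimate-0 s r x′ ⟩
    lookup% x′ r                  ∎

  induced-spread-strictlySurjective : Injective _≡_ _≡_ F → StrictlySurjective _≡_ F →
                                      StrictlySurjective _≡_ F-spread
  induced-spread-strictlySurjective F-injective F-surjective y = x , F-spread-x≡y
    where
    ζ : ℕ → Vec Bool n
    ζ r = proj₁ (F-surjective (decimate s r y))

    Fζ : ∀ r → F (ζ r) ≡ decimate s r y
    Fζ r = proj₂ (F-surjective (decimate s r y))

    shift-ζ : ∀ r t → shift t (ζ r) ≡ ζ (r + t * s)
    shift-ζ r t = F-injective {shift t (ζ r)} {ζ (r + t * s)} (begin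
      F (shift t (ζ r))           ≡⟨ induced-shift f t (ζ r) ⟩
      shift t (F (ζ r))           ≡⟨ cong (shift t) (Fζ r) ⟩
      shift t (decimate s r y)    ≡⟨ shift-decimate s r t y ⟩
      decimate s (r + t * s) y    ≡⟨ Fζ (r + t * s) ⟨
      F (ζ (r + t * s))           ∎)

    ζ-cong : ∀ {r r′} → r % n ≡ r′ % n → ζ r ≡ ζ r′
    ζ-cong {r} {r′} r≡r′ = F-injective {ζ r} {ζ r′} (trans (Fζ r) (trans (decimate-cong s y r≡r′) (sym (Fζ r′))))

    x : Vec Bool n
    x = tabulate λ i → lookup% (ζ (toℕ i)) 0

    decimate-x : ∀ r → decimate s r x ≡ ζ r
    decimate-x r = lookup%-ext λ b → begin
      lookup% (decimate s r x) b       ≡⟨ lookup%-decimate s r x b ⟩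
      lookup% x (r + b * s)            ≡⟨ lookup%-tabulate (λ c → lookup% (ζ c) 0) (r + b * s) ⟩
      lookup% (ζ ((r + b * s) % n)) 0  ≡⟨ cong (λ v → lookup% v 0) (ζ-cong (m%n%n≡m%n (r + b * s) n)) ⟩
      lookup% (ζ (r + b * s)) 0        ≡⟨ cong (λ v → lookup% v 0) (shift-ζ r b) ⟨
      lookup% (shift b (ζ r)) 0        ≡⟨ lookup%-shift b (ζ r) 0 ⟩
      lookup% (ζ r) b                  ∎

    F-spread-x≡y : F-spread x ≡ y
    F-spread-x≡y = lookup%-ext λ r → begin
      lookup% (F-spread x) r                 ≡⟨ lookup%-decimate-0 s r (F-spread x) ⟨
      lookup% (decimate s r (F-spread x)) 0  ≡⟨ cong (λ v → lookup% v 0) (decimate-induced-spread f s r x) ⟩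
      lookup% (F (decimate s r x)) 0         ≡⟨ cong (λ v → lookup% (F v) 0) (decimate-x r) ⟩
      lookup% (F (ζ r)) 0                    ≡⟨ cong (λ v → lookup% v 0) (Fζ r) ⟩
      lookup% (decimate s r y) 0             ≡⟨ lookup%-decimate-0 s r y ⟩
      lookup% y r                            ∎

  induced-spread-bijective : Bijective _≡_ _≡_ F → Bijective _≡_ _≡_ F-spread
  induced-spread-bijective (F-injective , F-surjective) =
    induced-spread-injective F-injective ,
    strictlySurjective⇒surjective
      (induced-spread-strictlySurjective F-injective (surjective⇒strictlySurjective F-surjective))

mainTheorem1 : (m : ℕ) → 1 ≤ m → (f : BoolFun (suc m)) → (s : ℕ) → 2 ≤ s →
    ((n : ℕ) → .{{_ : NonZero n}} → suc m ≤ n → IsLifting f n) →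
    (n : ℕ) → .{{_ : NonZero n}} → m * s + 1 ≤ n → IsLifting (spread f s) n
mainTheorem1 m _ f (suc s′) (s≤s _) lifting n m*s+1≤n =
  spread-hasDiameter m s′ (proj₁ (lifting (suc m) ≤-refl)) ,
  induced-spread-bijective f (suc s′) (proj₂ (lifting n k≤n))
  where
  k≤n : suc m ≤ n
  k≤n = ≤-trans (s≤s (m≤m*n m (suc s′))) (≤-trans (≤-reflexive (+-comm 1 (m * suc s′))) m*s+1≤n)
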